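{- Let $\mathbb F$ be a field and let $f$ be an $\mathbb F$-valued graph parameter that is not identically $0$. The following are equivalent: (1) $f$ is multiplicative; (2) $f(K_0)=1$ and $\operatorname{rk_\mathsf S} T(f,0,n)=1$ for all integers $n\ge 0$; (3) $f(K_0)=1$ and there exists some integer $n\ge 2$ with $\operatorname{rk_\mathsf S} T(f,0,n)=1$.
   Context: Graphs are finite, may have multiple edges but no loops. An $\mathbb F$-valued graph parameter is a function from graphs to $\mathbb F$ invariant under isomorphism. $K_0$ is the empty graph (no vertices). $f$ is multiplicative if $f(G_1\sqcup G_2)=f(G_1)f(G_2)$ for all graphs (disjoint union). For $k\ge 0$, a $k$-labeled graph is a graph in which $k$ distinct nodes carry labels $1,\dots,k$ (other nodes unlabeled); $k$-labeled graphs are identified up to label-preserving isomorphism, and a graph parameter ignores labels. The product $G_1G_2$ of two $k$-labeled graphs is obtained from their disjoint union by identifying nodes with the same label; for $k=0$ it is disjoint union. $\mathcal{PLG}[k]$ denotes the set of (isomorphism classes of) $k$-labeled graphs, and $U_k$ the $k$-labeled graph with $k$ labeled nodes and no edges. The connection tensor $T(f,k,n)$ is the function on $\mathcal{PLG}[k]^n$ with value $f(G_1\cdots G_n)$ at $(G_1,\dots,G_n)$; for $n=0$ it is the scalar $f(U_k)$. For $\mathbf x\in\mathbb F^{\mathcal{PLG}[k]}$, $\mathbf x^{\otimes n}$ is the function $(G_1,\dots,G_n)\mapsto\prod_i \mathbf x(G_i)$ (and $\mathbf x^{\otimes 0}=1$). The symmetric rank $\operatorname{rk_\mathsf S} T$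 is the least $r\ge 0$ such that $T=\sum_{i=1}^r\lambda_i\mathbf x_i^{\otimes n}$ with $\lambda_i\in\mathbb F$, $\mathbf x_i\in\mathbb F^{\mathcal{PLG}[k]}$ (and $\infty$ if no such expression exists). -}

module Defs where

open import Level using (Level; _⊔_) renaming (suc to lsuc)
open import Data.Nat using (ℕ; zero; suc; _<_) renaming (_+_ to _+ℕ_)
open import Data.Fin using (Fin; zero; suc; splitAt)
open import Data.Sum using (_⊎_; inj₁; inj₂)
open import Data.Product using (Σ; ∃; _×_; _,_)
open import Relation.Nullary using (¬_)
open import Relation.Binary.PropositionalEquality using (_≡_; refl)
open import Function.Bundles using (_↔_; Inverse)
open import Algebra.Bundles using (CommutativeRing)

record Field (c ℓ : Level) : Set (lsuc (c ⊔ ℓ)) where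
  field
    commutativeRing : CommutativeRing c ℓ
  open CommutativeRing commutativeRing public
  field
    0≉1     : ¬ (0# ≈ 1#)
    inverse : ∀ x → ¬ (x ≈ 0#) → Σ Carrier (λ y → x * y ≈ 1#)

record Graph : Set where
  field
    size     : ℕ
    mult     : Fin size → Fin size → ℕ
    sym      : ∀ i j → mult i j ≡ mult j i
    loopless : ∀ i → mult i i ≡ 0
open Graph public

record _≅_ (G H : Graph) : Set where
  field
    bij      : Fin (size G) ↔ Fin (size H)
    preserve : ∀ i j → mult G i j ≡ mult H (Inverse.to bij i) (Inverse.to bij j)

K₀ : Graph
K₀ = record { size = 0 ; mult = λ () ; sym = λ () ; loopless = λ () }

joinMult : ∀ {n m} → (Fin n → Fin n → ℕ) → (Fin m → Fin m → ℕ) →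
           Fin n ⊎ Fin m → Fin n ⊎ Fin m → ℕ
joinMult a b (inj₁ i) (inj₁ j) = a i j
joinMult a b (inj₁ i) (inj₂ j) = 0
joinMult a b (inj₂ i) (inj₁ j) = 0
joinMult a b (inj₂ i) (inj₂ j) = b i j

joinMult-sym : ∀ {n m} (a : Fin n → Fin n → ℕ) (b : Fin m → Fin m → ℕ) →
  (∀ i j → a i j ≡ a j i) → (∀ i j → b i j ≡ b j i) →
  ∀ x y → joinMult a b x y ≡ joinMult a b y x
joinMult-sym a b sa sb (inj₁ i) (inj₁ j) = sa i j
joinMult-sym a b sa sb (inj₁ i) (inj₂ j) = refl
joinMult-sym a b sa sb (inj₂ i) (inj₁ j) = refl
joinMult-sym a b sa sb (inj₂ i) (inj₂ j) = sb i j

joinMult-loop : ∀ {n m} (a : Fin n → Fin n → ℕ) (b : Fin m → Fin m → ℕ) →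
  (∀ i → a i i ≡ 0) → (∀ i → b i i ≡ 0) → ∀ x → joinMult a b x x ≡ 0
joinMult-loop a b la lb (inj₁ i) = la i
joinMult-loop a b la lb (inj₂ i) = lb i

_⊔ᴳ_ : Graph → Graph → Graph
G ⊔ᴳ H = record
  { size     = size G +ℕ size H
  ; mult     = λ i j → joinMult (mult G) (mult H) (splitAt (size G) i) (splitAt (size G) j)
  ; sym      = λ i j → joinMult-sym (mult G) (mult H) (sym G) (sym H)
                         (splitAt (size G) i) (splitAt (size G) j)
  ; loopless = λ i → joinMult-loop (mult G) (mult H) (loopless G) (loopless H)
                         (splitAt (size G) i)
  }

-- Product of n 0-labeled graphs = iterated disjoint union (with K₀ = U₀
-- as the empty product).
⨆ : ∀ n → (Fin n → Graph) → Graph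
⨆ zero    G = K₀
⨆ (suc n) G = G zero ⊔ᴳ ⨆ n (λ i → G (suc i))

module _ {c ℓ : Level} (F : Field c ℓ) where
  open Field F using (Carrier; _≈_; _+_; _*_; 0#; 1#)

  -- F-valued graph parameter: invariant under isomorphism.  Functions on
  -- PLG[0] (isomorphism classes of graphs) are represented the same way.
  IsGraphParameter : (Graph → Carrier) → Set ℓ
  IsGraphParameter f = ∀ {G H} → G ≅ H → f G ≈ f H

  record FnOnPLG0 : Set (c ⊔ ℓ) where
    field
      fn        : Graph → Carrier
      invariant : IsGraphParameter fn
  open FnOnPLG0 public

  NotIdenticallyZero : (Graph → Carrier) → Set ℓ
  NotIdenticallyZero f = Σ Graph (λ G → ¬ (f G ≈ 0#))

  Multiplicative : (Graph → Carrier) → Set ℓ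
  Multiplicative f = ∀ G₁ G₂ → f (G₁ ⊔ᴳ G₂) ≈ f G₁ * f G₂

  sumF : ∀ r → (Fin r → Carrier) → Carrier
  sumF zero    g = 0#
  sumF (suc r) g = g zero + sumF r (λ i → g (suc i))

  prodF : ∀ r → (Fin r → Carrier) → Carrier
  prodF zero    g = 1#
  prodF (suc r) g = g zero * prodF r (λ i → g (suc i))

  ConnTensor0 : (Graph → Carrier) → ∀ n → (Fin n → Graph) → Carrier
  ConnTensor0 f n Gs = f (⨆ n Gs)

  tensorPower : FnOnPLG0 → ∀ n → (Fin n → Graph) → Carrier
  tensorPower x n Gs = prodF n (λ i → fn x (Gs i))

  HasSymDecomp : ∀ n → ((Fin n → Graph) → Carrier) → ℕ → Set (c ⊔ ℓ)
  HasSymDecomp n T r =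
    Σ (Fin r → Carrier) λ lam → Σ (Fin r → FnOnPLG0) λ xs →
      ∀ Gs → T Gs ≈ sumF r (λ i → lam i * tensorPower (xs i) n Gs)

  SymRankIs : ∀ n → ((Fin n → Graph) → Carrier) → ℕ → Set (c ⊔ ℓ)
  SymRankIs n T r = HasSymDecomp n T r × (∀ r′ → r′ < r → ¬ HasSymDecomp n T r′)

module Submission where

-- We prove the cycle (1) ⇒ (2) ⇒ (3) ⇒ (1).
--   (1) ⇒ (2): cancelling f(G₀) ≠ 0 in f(G₀) = f(G₀ ⊔ K₀) = f(G₀) f(K₀)
--     gives f(K₀) = 1, hence f(G₁ ⊔ ⋯ ⊔ Gₙ) = ∏ f(Gᵢ), i.e. T = 1 · f^{⊗n};
--     rank 0 is impossible because T(G₀,…,G₀) = f(G₀)ⁿ ≠ 0.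
--   (2) ⇒ (3): take n = 2.
--   (3) ⇒ (1): write T(f,0,m+2) = λ x^{⊗(m+2)} and evaluate it at tuples
--     padded with copies of K₀ (which do not change the union up to
--     isomorphism).  With a = x(K₀) and c = λ aᵐ this gives c a² = 1,
--     f(G) = c x(G) a and f(G ⊔ H) = c x(G) x(H), whence
--     f(G) f(H) = f(G ⊔ H) · c a² = f(G ⊔ H).

open import Defs hiding (sym)
open import Level using (Level; _⊔_)
open import Data.Nat using (ℕ; zero; suc; _≥_; s≤s; z≤n)
open import Data.Fin using (Fin; zero; suc; splitAt; join; _↑ˡ_)
open import Data.Fin.Properties using (+↔⊎; splitAt-join; join-splitAt)
open import Data.Sum using (_⊎_; inj₁; inj₂)
open import Data.Sum.Function.Propositional using (_⊎-↔_)
open import Data.Product using (Σ; _×_; _,_)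
open import Data.Vec.Functional using (_∷_; replicate)
open import Relation.Binary.PropositionalEquality as ≡ using (_≡_; refl)
open import Function.Base using (_∘_)
open import Function.Bundles using (_⇔_; _↔_; Inverse; mk↔ₛ′; mk⇔)
open import Function.Construct.Composition using (_↔-∘_)
open import Function.Properties.Inverse using (↔-refl; ↔-sym)
import Relation.Binary.Reasoning.Setoid as SetoidReasoning
import Algebra.Solver.CommutativeMonoid as CommutativeMonoidSolver

≅-refl : ∀ {G} → G ≅ G
≅-refl = record { bij = ↔-refl ; preserve = λ _ _ → refl }

≅-trans : ∀ {G H K} → G ≅ H → H ≅ K → G ≅ K
≅-trans G≅H H≅K = record
  { bij      = _≅_.bij H≅K ↔-∘ _≅_.bij G≅H
  ; preserve = λ i j → ≡.trans (_≅_.preserve G≅H i j) (_≅_.preserve H≅K _ _)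
  }

-- K₀ is a left unit for ⊔ on the nose: Fin (0 + n) is Fin n and
-- splitAt 0 i computes to inj₂ i.
⊔-unitˡ : ∀ G → (K₀ ⊔ᴳ G) ≅ G
⊔-unitˡ G = ≅-refl

-- K₀ is a right unit for ⊔: the vertices of G ⊔ K₀ all lie in the left part.
⊔-unitʳ : ∀ G → (G ⊔ᴳ K₀) ≅ G
⊔-unitʳ G = record
  { bij      = mk↔ₛ′ (λ i → fromLeft (splitAt n i)) (_↑ˡ 0)
                 (λ j → ≡.cong fromLeft (splitAt-join n 0 (inj₁ j)))
                 (λ i → ≡.trans (joinLeft (splitAt n i)) (join-splitAt n 0 i))
  ; preserve = λ i j → preserve (splitAt n i) (splitAt n j)
  }
  where
  n = size G
  fromLeft : Fin n ⊎ Fin 0 → Fin n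
  fromLeft (inj₁ i) = i
  joinLeft : ∀ s → fromLeft s ↑ˡ 0 ≡ join n 0 s
  joinLeft (inj₁ i) = refl
  preserve : ∀ s t → joinMult (mult G) (mult K₀) s t ≡ mult G (fromLeft s) (fromLeft t)
  preserve (inj₁ i) (inj₁ j) = refl

⊔-congʳ : ∀ G {H H′} → H ≅ H′ → (G ⊔ᴳ H) ≅ (G ⊔ᴳ H′)
⊔-congʳ G {H} {H′} H≅H′ = record
  { bij      = ↔-sym +↔⊎ ↔-∘ (relabel ↔-∘ +↔⊎)
  ; preserve = λ i j → ≡.trans (preserve (splitAt g i) (splitAt g j))
      (≡.sym (≡.cong₂ (joinMult (mult G) (mult H′))
        (splitAt-join g (size H′) (Inverse.to relabel (splitAt g i)))
        (splitAt-join g (size H′) (Inverse.to relabel (splitAt g j)))))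
  }
  where
  g = size G
  relabel : (Fin g ⊎ Fin (size H)) ↔ (Fin g ⊎ Fin (size H′))
  relabel = ↔-refl ⊎-↔ _≅_.bij H≅H′
  preserve : ∀ s t → joinMult (mult G) (mult H) s t
                   ≡ joinMult (mult G) (mult H′) (Inverse.to relabel s) (Inverse.to relabel t)
  preserve (inj₁ i) (inj₁ j) = refl
  preserve (inj₁ i) (inj₂ j) = refl
  preserve (inj₂ i) (inj₁ j) = refl
  preserve (inj₂ i) (inj₂ j) = _≅_.preserve H≅H′ i j

⨆-K₀ : ∀ m → ⨆ m (replicate m K₀) ≅ K₀
⨆-K₀ zero    = ≅-refl
⨆-K₀ (suc m) = ≅-trans (⊔-unitˡ _) (⨆-K₀ m)

⨆-pad₁ : ∀ m G → ⨆ (suc m) (G ∷ replicate m K₀) ≅ G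
⨆-pad₁ m G = ≅-trans (⊔-congʳ G (⨆-K₀ m)) (⊔-unitʳ G)

⨆-pad₂ : ∀ m G H → ⨆ (suc (suc m)) (G ∷ H ∷ replicate m K₀) ≅ (G ⊔ᴳ H)
⨆-pad₂ m G H = ⊔-congʳ G (⨆-pad₁ m H)

module FieldFacts {c ℓ : Level} (F : Field c ℓ) where
  open Field F hiding (zero)
  open SetoidReasoning setoid

  *-cancelˡ : ∀ {x y z} → x ≉ 0# → x * y ≈ x * z → y ≈ z
  *-cancelˡ {x} {y} {z} x≉0 xy≈xz with inverse x x≉0
  ... | x⁻¹ , xx⁻¹≈1 = begin
    y              ≈⟨ sym (*-identityˡ y) ⟩
    1# * y         ≈⟨ *-congʳ x⁻¹x≈1 ⟨
    (x⁻¹ * x) * y  ≈⟨ *-assoc x⁻¹ x y ⟩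
    x⁻¹ * (x * y)  ≈⟨ *-congˡ xy≈xz ⟩
    x⁻¹ * (x * z)  ≈⟨ *-assoc x⁻¹ x z ⟨
    (x⁻¹ * x) * z  ≈⟨ *-congʳ x⁻¹x≈1 ⟩
    1# * z         ≈⟨ *-identityˡ z ⟩
    z              ∎
    where
    x⁻¹x≈1 : x⁻¹ * x ≈ 1#
    x⁻¹x≈1 = trans (*-comm x⁻¹ x) xx⁻¹≈1

  *-nonzero : ∀ {x y} → x ≉ 0# → y ≉ 0# → x * y ≉ 0#
  *-nonzero {x} {y} x≉0 y≉0 xy≈0 = y≉0 (*-cancelˡ x≉0 (trans xy≈0 (sym (zeroʳ x))))

  prodF-nonzero : ∀ n (g : Fin n → Carrier) → (∀ i → g i ≉ 0#) → prodF F n g ≉ 0#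
  prodF-nonzero zero    g g≉0 1≈0 = 0≉1 (sym 1≈0)
  prodF-nonzero (suc n) g g≉0 =
    *-nonzero (g≉0 zero) (prodF-nonzero n (λ i → g (suc i)) (λ i → g≉0 (suc i)))

  -- The commutative-monoid rearrangement behind (3) ⇒ (1).
  swap-middle : ∀ l u v a b →
    (l * (u * (a * b))) * (l * (v * (a * b))) ≈ (l * (u * (v * b))) * (l * (a * (a * b)))
  swap-middle = solve 5 (λ l u v a b →
      (l ⊕ (u ⊕ (a ⊕ b))) ⊕ (l ⊕ (v ⊕ (a ⊕ b))) ⊜ (l ⊕ (u ⊕ (v ⊕ b))) ⊕ (l ⊕ (a ⊕ (a ⊕ b))))
    (Field.refl F)
    where open CommutativeMonoidSolver *-commutativeMonoid

module Decompositions {c ℓ : Level} (F : Field c ℓ) where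
  open Field F hiding (zero)

  single-term : ∀ n {T} → HasSymDecomp F n T 1 →
    Σ Carrier λ λ₀ → Σ (FnOnPLG0 F) λ x → ∀ Gs → T Gs ≈ λ₀ * tensorPower F x n Gs
  single-term n (lam , xs , T≈) = lam zero , xs zero , λ Gs → trans (T≈ Gs) (+-identityʳ _)

  -- A tensor with a nonzero entry has no empty decomposition, so a
  -- decomposition of length one witnesses rank exactly one.
  rank-one : ∀ n {T} → HasSymDecomp F n T 1 → Σ (Fin n → Graph) (λ Gs → T Gs ≉ 0#) →
    SymRankIs F n T 1
  rank-one n decomp (Gs , TGs≉0) = decomp , λ { zero (s≤s z≤n) (_ , _ , T≈0) → TGs≉0 (T≈0 Gs) }

module Implications {c ℓ : Level} (F : Field c ℓ) (f : Graph → Field.Carrier F)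
                    (invariant : IsGraphParameter F f) where
  open Field F hiding (zero)
  open SetoidReasoning setoid
  open FieldFacts F
  open Decompositions F

  T : ∀ n → (Fin n → Graph) → Carrier
  T = ConnTensor0 F f

  f-as-function : FnOnPLG0 F
  f-as-function = record { fn = f ; invariant = invariant }

  -- (1) ⇒ f(K₀) = 1, by cancelling f(G₀) ≠ 0 in f(G₀) = f(G₀ ⊔ K₀) = f(G₀) f(K₀).
  multiplicative⇒unit : NotIdenticallyZero F f → Multiplicative F f → f K₀ ≈ 1#
  multiplicative⇒unit (G₀ , fG₀≉0) mult = sym (*-cancelˡ fG₀≉0 (begin
    f G₀ * 1#          ≈⟨ *-identityʳ (f G₀) ⟩
    f G₀               ≈⟨ invariant (⊔-unitʳ G₀) ⟨
    f (G₀ ⊔ᴳ K₀)       ≈⟨ mult G₀ K₀ ⟩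
    f G₀ * f K₀        ∎))

  multiplicative⇒power : Multiplicative F f → f K₀ ≈ 1# →
    ∀ n Gs → T n Gs ≈ tensorPower F f-as-function n Gs
  multiplicative⇒power mult unit zero    Gs = unit
  multiplicative⇒power mult unit (suc n) Gs =
    trans (mult (Gs zero) _) (*-congˡ (multiplicative⇒power mult unit n (λ i → Gs (suc i))))

  multiplicative⇒rank-one : NotIdenticallyZero F f → Multiplicative F f →
    ∀ n → SymRankIs F n (T n) 1
  multiplicative⇒rank-one nz@(G₀ , fG₀≉0) mult n = rank-one n decomp (replicate n G₀ , T≉0)
    where
    unit : f K₀ ≈ 1#
    unit = multiplicative⇒unit nz mult
    decomp : HasSymDecomp F n (T n) 1
    decomp = (λ _ → 1#) , (λ _ → f-as-function) , λ Gs →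
      trans (multiplicative⇒power mult unit n Gs) (sym (trans (+-identityʳ _) (*-identityˡ _)))
    T≉0 : T n (replicate n G₀) ≉ 0#
    T≉0 T≈0 = prodF-nonzero n (λ _ → f G₀) (λ _ → fG₀≉0)
                (trans (sym (multiplicative⇒power mult unit n (replicate n G₀))) T≈0)

  -- (3) ⇒ (1): evaluate T = λ x^{⊗(m+2)} at tuples padded with K₀.
  rank-one⇒multiplicative : f K₀ ≈ 1# → ∀ m → HasSymDecomp F (suc (suc m)) (T (suc (suc m))) 1 →
    Multiplicative F f
  rank-one⇒multiplicative unit m decomp G H with single-term (suc (suc m)) decomp
  ... | λ₀ , x , T≈ = begin
    f (G ⊔ᴳ H)                                    ≈⟨ *-identityʳ _ ⟨
    f (G ⊔ᴳ H) * 1#                               ≈⟨ *-cong (sym fGH) unit-eq ⟨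
    (λ₀ * (fn x G * (fn x H * aᵐ))) * (λ₀ * (a * (a * aᵐ)))
      ≈⟨ swap-middle λ₀ (fn x G) (fn x H) a aᵐ ⟨
    (λ₀ * (fn x G * (a * aᵐ))) * (λ₀ * (fn x H * (a * aᵐ)))
      ≈⟨ *-cong (fG G) (fG H) ⟨
    f G * f H                                     ∎
    where
    a aᵐ : Carrier
    a = fn x K₀
    aᵐ = prodF F m (λ _ → a)
    -- T(K₀,…,K₀) = f(K₀) = 1
    unit-eq : λ₀ * (a * (a * aᵐ)) ≈ 1#
    unit-eq = trans (sym (T≈ (replicate (suc (suc m)) K₀)))
                    (trans (invariant (⨆-K₀ (suc (suc m)))) unit)
    -- T(G,K₀,…,K₀) = f(G)
    fG : ∀ G → f G ≈ λ₀ * (fn x G * (a * aᵐ))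
    fG G = trans (sym (invariant (⨆-pad₁ (suc m) G))) (T≈ (G ∷ replicate (suc m) K₀))
    -- T(G,H,K₀,…,K₀) = f(G ⊔ H)
    fGH : f (G ⊔ᴳ H) ≈ λ₀ * (fn x G * (fn x H * aᵐ))
    fGH = trans (sym (invariant (⨆-pad₂ m G H))) (T≈ (G ∷ H ∷ replicate m K₀))

  RankOneForAll : Set (c ⊔ ℓ)
  RankOneForAll = f K₀ ≈ 1# × (∀ n → SymRankIs F n (T n) 1)

  RankOneForSome : Set (c ⊔ ℓ)
  RankOneForSome = f K₀ ≈ 1# × Σ ℕ (λ n → n ≥ 2 × SymRankIs F n (T n) 1)

  one⇒two : NotIdenticallyZero F f → Multiplicative F f → RankOneForAll
  one⇒two nz mult = multiplicative⇒unit nz mult , multiplicative⇒rank-one nz mult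

  two⇒three : RankOneForAll → RankOneForSome
  two⇒three (unit , rank) = unit , 2 , s≤s (s≤s z≤n) , rank 2

  three⇒one : RankOneForSome → Multiplicative F f
  three⇒one (_    , suc zero    , s≤s () , _)
  three⇒one (unit , suc (suc m) , _      , (decomp , _)) = rank-one⇒multiplicative unit m decomp

proposition3p2 : {c ℓ : Level} (F : Field c ℓ) (f : Graph → Field.Carrier F) →
    IsGraphParameter F f → NotIdenticallyZero F f →
    (Multiplicative F f ⇔ (Field._≈_ F (f K₀) (Field.1# F) × (∀ (n : ℕ) → SymRankIs F n (ConnTensor0 F f n) 1)))
    × (Multiplicative F f ⇔ (Field._≈_ F (f K₀) (Field.1# F) × Σ ℕ (λ n → n ≥ 2 × SymRankIs F n (ConnTensor0 F f n) 1)))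
proposition3p2 F f invariant nz =
    mk⇔ (one⇒two nz) (three⇒one ∘ two⇒three)
  , mk⇔ (two⇒three ∘ one⇒two nz) three⇒one
  where open Implications F f invariant
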